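{- Let $n\ge 2$, $1\le m\le n$. For $1\le k\le n$ let $x_k=(x_k(w))_{w\in\mathfrak{S}_n}$ and $y_k=(y_k(w))_{w\in\mathfrak{S}_n}$ be the tuples of polynomials in $\mathbb{C}[t_1,\ldots,t_n]$ with $x_k(w)=t_{w(k)}$ and $y_k(w)=\prod_{\ell=n-m+1}^{n-1}(t_k-t_{w(\ell)})$ if $w(n)=k$, $y_k(w)=0$ otherwise; let $t_k$ also denote the constant tuple $(t_k)_w$; tuples are multiplied and added componentwise. Then: (1) $y_ky_{k'}=0$ for all $k\ne k'$; (2) $x_ny_k=t_ky_k$ for all $k$; (3) $y_k\prod_{\ell=1}^{n-m}(t_k-x_\ell)=\prod_{\ell=1}^{n-1}(t_k-x_\ell)$ for all $k$; (4) $\sum_{k=1}^n y_k=\prod_{\ell=n-m+1}^{n-1}(x_n-x_\ell)$, with the conventions that empty products equal $1$.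
   Context: These tuples are the classes defining the GKM description of the equivariant cohomology of the regular semisimple Hessenberg variety for $h'=((n-1)^{n-m},n^m)$. -}

module Defs where

open import Level using (Level)
open import Algebra.Bundles using (CommutativeRing)
open import Data.Nat using (ℕ; suc; _∸_; _≤ᵇ_)
open import Data.Bool using (Bool; _∧_; if_then_else_)
open import Data.Fin using (Fin; toℕ; fromℕ; _≟_)
open import Data.Fin.Permutation using (Permutation′; _⟨$⟩ʳ_)
open import Data.List using (List; foldr; map)
open import Data.List.Base using (allFin)
open import Relation.Nullary using (yes; no)

-- N = suc n' is the paper's n; indices are Fin N
-- (paper's index k corresponds to toℕ k + 1).  The polynomials t_1..t_N are
-- elements t of an arbitrary commutative ring.
module GKM {c ℓ : Level} (R : CommutativeRing c ℓ) (n' m : ℕ)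
           (t : Fin (suc n') → CommutativeRing.Carrier R) where
  open CommutativeRing R

  N : ℕ
  N = suc n'

  prodFin : (Fin N → Carrier) → Carrier
  prodFin f = foldr _*_ 1# (map f (allFin N))

  sumFin : (Fin N → Carrier) → Carrier
  sumFin f = foldr _+_ 0# (map f (allFin N))

  -- ∏_{ℓ = lo}^{hi} f ℓ, with 1-based bounds (paper's convention); empty = 1
  prodRange : ℕ → ℕ → (Fin N → Carrier) → Carrier
  prodRange lo hi f =
    prodFin (λ l → if (lo ≤ᵇ suc (toℕ l)) ∧ (suc (toℕ l) ≤ᵇ hi) then f l else 1#)

  Tuple : Set c
  Tuple = Permutation′ N → Carrier

  _⊕_ : Tuple → Tuple → Tuple
  (f ⊕ g) w = f w + g w

  _⊗_ : Tuple → Tuple → Tuple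
  (f ⊗ g) w = f w * g w

  _≋_ : Tuple → Tuple → Set ℓ
  f ≋ g = ∀ w → f w ≈ g w

  const : Carrier → Tuple
  const a w = a

  𝟘 : Tuple
  𝟘 = const 0#

  prodRangeT : ℕ → ℕ → (Fin N → Tuple) → Tuple
  prodRangeT lo hi F w = prodRange lo hi (λ l → F l w)

  sumFinT : (Fin N → Tuple) → Tuple
  sumFinT F w = sumFin (λ k → F k w)

  last : Fin N
  last = fromℕ n'

  x : Fin N → Tuple
  x k w = t (w ⟨$⟩ʳ k)

  y : Fin N → Tuple
  y k w with w ⟨$⟩ʳ last ≟ k
  ... | yes _ = prodRange (suc (N ∸ m)) (N ∸ 1) (λ l → t k - t (w ⟨$⟩ʳ l))
  ... | no  _ = 0#

{-# OPTIONS --safe #-}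

-- At a permutation w the only nonzero y_k is y_{w(n)}, which gives (1), (2)
-- and (4) at once.  For (3) at k = w(n), the products over n-m+1..n-1 and
-- 1..n-m combine into the product over 1..n-1; at k ≠ w(n) both sides
-- vanish, the right one because ℓ = w⁻¹(k) < n contributes t_k - t_{w(ℓ)} = 0.

module Submission where

open import Defs
open import Level using (Level)
open import Algebra.Bundles using (CommutativeRing)
open import Data.Nat using (ℕ; zero; suc; _≤_; _<_; _∸_; _≤ᵇ_; s≤s; z≤n)
open import Data.Nat.Properties
  using (_≤?_; ≤-trans; ≰⇒>; <⇒≱; ≤ᵇ⇒≤; ≤⇒≤ᵇ; ∸-monoʳ-≤)
open import Data.Bool using (true; false; T; _∧_; if_then_else_)
open import Data.Bool.Properties using (T-≡)
open import Data.Fin as Fin using (Fin; toℕ; fromℕ; _≟_)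
open import Data.Fin.Properties using (≤fromℕ; ≤∧≢⇒<; toℕ-fromℕ; punchInᵢ≢i)
open import Data.Fin.Permutation using (Permutation′; _⟨$⟩ʳ_; _⟨$⟩ˡ_; inverseʳ)
import Data.List as List
open import Data.List.Properties using (map-tabulate)
import Data.Vec.Functional as Vector
open import Data.Vec.Functional using (Vector; removeAt)
open import Data.Product using (_×_; _,_)
open import Data.Empty using (⊥-elim)
open import Function using (_∘_; id; Equivalence)
open import Relation.Nullary using (yes; no; contradiction)
open import Relation.Binary.PropositionalEquality as ≡ using (_≡_; _≢_; ≢-sym)

foldr-tabulate : ∀ {a b} {A : Set a} {B : Set b} (f : A → B → B) (e : B) {n}
                 (g : Fin n → A) →
                 List.foldr f e (List.tabulate g) ≡ Vector.foldr f e g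
foldr-tabulate f e {zero}  g = ≡.refl
foldr-tabulate f e {suc n} g = ≡.cong (f (g Fin.zero)) (foldr-tabulate f e (g ∘ Fin.suc))

≤ᵇ-true : ∀ {m n} → m ≤ n → (m ≤ᵇ n) ≡ true
≤ᵇ-true = Equivalence.to T-≡ ∘ ≤⇒≤ᵇ

≤ᵇ-false : ∀ {m n} → n < m → (m ≤ᵇ n) ≡ false
≤ᵇ-false {m} {n} n<m with m ≤ᵇ n in eq
... | false = ≡.refl
... | true  = contradiction (≤ᵇ⇒≤ m n (≡.subst T (≡.sym eq) _)) (<⇒≱ n<m)

≢fromℕ⇒toℕ< : ∀ {n} {i : Fin (suc n)} → i ≢ fromℕ n → toℕ i < n
≢fromℕ⇒toℕ< {n} {i} i≢n = ≡.subst (toℕ i <_) (toℕ-fromℕ n) (≤∧≢⇒< (≤fromℕ i) i≢n)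

module _ {c ℓ : Level} (R : CommutativeRing c ℓ) where
  open CommutativeRing R
  open import Relation.Binary.Reasoning.Setoid setoid
  open import Algebra.Properties.CommutativeMonoid.Sum +-commutativeMonoid
    using (sum; sum-cong-≋; sum-remove; sum-replicate-zero)
  open import Algebra.Properties.CommutativeMonoid.Sum *-commutativeMonoid
    using ()
    renaming (sum to product; sum-cong-≋ to product-cong; sum-remove to product-remove;
              ∑-distrib-+ to product-distrib-*)

  sum-≈0 : ∀ {n} {f : Vector Carrier n} → (∀ i → f i ≈ 0#) → sum f ≈ 0#
  sum-≈0 {n} f≈0 = trans (sum-cong-≋ f≈0) (sum-replicate-zero n)

  sum-supported-at : ∀ {n} (f : Vector Carrier (suc n)) i →
                     (∀ j → j ≢ i → f j ≈ 0#) → sum f ≈ f i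
  sum-supported-at f i vanish = begin
    sum f                    ≈⟨ sum-remove f ⟩
    f i + sum (removeAt f i) ≈⟨ +-congˡ (sum-≈0 (λ j → vanish (Fin.punchIn i j) (punchInᵢ≢i i j))) ⟩
    f i + 0#                 ≈⟨ +-identityʳ (f i) ⟩
    f i                      ∎

  product-≈0 : ∀ {n} (f : Vector Carrier (suc n)) i → f i ≈ 0# → product f ≈ 0#
  product-≈0 f i fi≈0 = begin
    product f                        ≈⟨ product-remove f ⟩
    f i * product (removeAt f i)     ≈⟨ *-congʳ fi≈0 ⟩
    0# * product (removeAt f i)      ≈⟨ zeroˡ _ ⟩
    0#                               ∎

  module _ (n' m : ℕ) (t : Fin (suc n') → Carrier) where
    open GKM R n' m t

    rangeFactor : ℕ → ℕ → (Fin N → Carrier) → Fin N → Carrier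
    rangeFactor lo hi f l = if (lo ≤ᵇ suc (toℕ l)) ∧ (suc (toℕ l) ≤ᵇ hi) then f l else 1#

    prodFin≡product : ∀ f → prodFin f ≡ product f
    prodFin≡product f = ≡.trans (≡.cong (List.foldr _*_ 1#) (map-tabulate id f))
                                (foldr-tabulate _*_ 1# f)

    prodRange≡product : ∀ lo hi f → prodRange lo hi f ≡ product (rangeFactor lo hi f)
    prodRange≡product lo hi f = prodFin≡product (rangeFactor lo hi f)

    sumFin≡sum : ∀ f → sumFin f ≡ sum f
    sumFin≡sum f = ≡.trans (≡.cong (List.foldr _+_ 0#) (map-tabulate id f))
                           (foldr-tabulate _+_ 0# f)

    rangeFactor-split : ∀ {p q} → p ≤ q → ∀ f l →
                        rangeFactor (suc p) q f l * rangeFactor 1 p f l ≈ rangeFactor 1 q f l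
    rangeFactor-split {p} {q} p≤q f l with suc (toℕ l) ≤? p
    ... | yes l<p rewrite ≤ᵇ-false {suc p} (s≤s l<p) | ≤ᵇ-true l<p | ≤ᵇ-true (≤-trans l<p p≤q)
      = *-identityˡ (f l)
    ... | no l≮p rewrite ≤ᵇ-false {suc (toℕ l)} (≰⇒> l≮p) | ≤ᵇ-true (≰⇒> l≮p)
      = *-identityʳ _

    prodRange-split : ∀ {p q} → p ≤ q → ∀ f →
                      prodRange (suc p) q f * prodRange 1 p f ≈ prodRange 1 q f
    prodRange-split {p} {q} p≤q f = begin
      prodRange (suc p) q f * prodRange 1 p f
        ≡⟨ ≡.cong₂ _*_ (prodRange≡product (suc p) q f) (prodRange≡product 1 p f) ⟩
      product (rangeFactor (suc p) q f) * product (rangeFactor 1 p f)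
        ≈⟨ product-distrib-* (rangeFactor (suc p) q f) (rangeFactor 1 p f) ⟨
      product (λ l → rangeFactor (suc p) q f l * rangeFactor 1 p f l)
        ≈⟨ product-cong (rangeFactor-split p≤q f) ⟩
      product (rangeFactor 1 q f)
        ≡⟨ prodRange≡product 1 q f ⟨
      prodRange 1 q f ∎

    prodRange-≈0 : ∀ {lo hi} f l → lo ≤ suc (toℕ l) → suc (toℕ l) ≤ hi → f l ≈ 0# →
                   prodRange lo hi f ≈ 0#
    prodRange-≈0 {lo} {hi} f l lo≤l l≤hi fl≈0 =
      trans (reflexive (prodRange≡product lo hi f)) (product-≈0 (rangeFactor lo hi f) l factor≈0)
      where
        factor≈0 : rangeFactor lo hi f l ≈ 0#
        factor≈0 rewrite ≤ᵇ-true lo≤l | ≤ᵇ-true l≤hi = fl≈0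

    preimage-below-last : ∀ (w : Permutation′ N) k → w ⟨$⟩ʳ last ≢ k → suc (toℕ (w ⟨$⟩ˡ k)) ≤ n'
    preimage-below-last w k w[last]≢k = ≢fromℕ⇒toℕ< w⁻¹k≢last
      where
        w⁻¹k≢last : w ⟨$⟩ˡ k ≢ last
        w⁻¹k≢last eq = w[last]≢k (≡.trans (≡.cong (w ⟨$⟩ʳ_) (≡.sym eq)) (inverseʳ w))

    y-off-top : ∀ (w : Permutation′ N) k → w ⟨$⟩ʳ last ≢ k → y k w ≈ 0#
    y-off-top w k w[last]≢k with w ⟨$⟩ʳ last ≟ k
    ... | yes w[last]≡k = ⊥-elim (w[last]≢k w[last]≡k)
    ... | no  _         = refl

    y-at-top : ∀ (w : Permutation′ N) → y (w ⟨$⟩ʳ last) w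
                     ≈ prodRange (suc (N ∸ m)) (N ∸ 1) (λ l → t (w ⟨$⟩ʳ last) - t (w ⟨$⟩ʳ l))
    y-at-top w with w ⟨$⟩ʳ last ≟ w ⟨$⟩ʳ last
    ... | yes _ = refl
    ... | no w[last]≢w[last] = ⊥-elim (w[last]≢w[last] ≡.refl)

    y-orthogonal : ∀ k k' → k ≢ k' → (y k ⊗ y k') ≋ 𝟘
    y-orthogonal k k' k≢k' w with w ⟨$⟩ʳ last ≟ k | w ⟨$⟩ʳ last ≟ k'
    ... | yes w[last]≡k | yes w[last]≡k' = ⊥-elim (k≢k' (≡.trans (≡.sym w[last]≡k) w[last]≡k'))
    ... | yes _ | no _ = zeroʳ _
    ... | no _  | _    = zeroˡ _

    x-last-y : ∀ k → (x last ⊗ y k) ≋ (const (t k) ⊗ y k)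
    x-last-y k w with w ⟨$⟩ʳ last ≟ k
    ... | yes w[last]≡k = *-congʳ (reflexive (≡.cong t w[last]≡k))
    ... | no  _         = trans (zeroʳ _) (sym (zeroʳ _))

    y-complement : 1 ≤ m → ∀ k →
      (y k ⊗ prodRangeT 1 (N ∸ m) (λ l → const (t k) ⊕ (λ w → - x l w)))
        ≋ prodRangeT 1 (N ∸ 1) (λ l → const (t k) ⊕ (λ w → - x l w))
    y-complement 1≤m k w with w ⟨$⟩ʳ last ≟ k
    ... | yes _ = prodRange-split (∸-monoʳ-≤ N 1≤m) (λ l → t k - t (w ⟨$⟩ʳ l))
    ... | no w[last]≢k = trans (zeroˡ _) (sym (prodRange-≈0 _ (w ⟨$⟩ˡ k)
                                 (s≤s z≤n) (preimage-below-last w k w[last]≢k) factor≈0))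
      where
        factor≈0 : t k - t (w ⟨$⟩ʳ (w ⟨$⟩ˡ k)) ≈ 0#
        factor≈0 = trans (+-congˡ (-‿cong (reflexive (≡.cong t (inverseʳ w)))))
                         (-‿inverseʳ (t k))

    sum-y : sumFinT y ≋ prodRangeT (suc (N ∸ m)) (N ∸ 1) (λ l → x last ⊕ (λ w → - x l w))
    sum-y w = begin
      sumFin (λ k → y k w)   ≡⟨ sumFin≡sum (λ k → y k w) ⟩
      sum (λ k → y k w)      ≈⟨ sum-supported-at (λ k → y k w) (w ⟨$⟩ʳ last)
                                                 (λ k → y-off-top w k ∘ ≢-sym) ⟩
      y (w ⟨$⟩ʳ last) w      ≈⟨ y-at-top w ⟩
      prodRange (suc (N ∸ m)) (N ∸ 1) (λ l → t (w ⟨$⟩ʳ last) - t (w ⟨$⟩ʳ l)) ∎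

mainTheorem7 : ∀ {c ℓ : Level} (R : CommutativeRing c ℓ) (n' m : ℕ) →
  1 ≤ n' → 1 ≤ m → m ≤ suc n' →
  (t : Fin (suc n') → CommutativeRing.Carrier R) →
  let open CommutativeRing R
      open GKM R n' m t
  in (∀ k k' → k ≢ k' → (y k ⊗ y k') ≋ 𝟘)
     × (∀ k → (x last ⊗ y k) ≋ (const (t k) ⊗ y k))
     × (∀ k → (y k ⊗ prodRangeT 1 (N ∸ m) (λ l → const (t k) ⊕ (λ w → - x l w)))
              ≋ prodRangeT 1 (N ∸ 1) (λ l → const (t k) ⊕ (λ w → - x l w)))
     × (sumFinT y ≋ prodRangeT (suc (N ∸ m)) (N ∸ 1) (λ l → x last ⊕ (λ w → - x l w)))
mainTheorem7 R n' m _ 1≤m _ t =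
  y-orthogonal R n' m t , x-last-y R n' m t , y-complement R n' m t 1≤m , sum-y R n' m t
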